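{- $\mathsf{ECT} \le_{\mathrm W} \mathsf{WOP}(X\mapsto X^\omega)$.
   Context: A problem is a partial multi-valued function from instances to sets of solutions. $\mathsf P\le_{\mathrm W}\mathsf Q$ means there are Turing functionals $H,K$ such that for every $\mathsf P$-instance $X$, $H(X)$ is a $\mathsf Q$-instance, and for every $\mathsf Q$-solution $\hat Y$ to $H(X)$, $K(X\oplus\hat Y)$ is a $\mathsf P$-solution to $X$. $\mathsf{ECT}$: instances are pairs $(n,f)$ with $f:\mathbb N\to\{0,\dots,n-1\}$; $b$ is a solution iff for every $x>b$ there is $y>x$ with $f(x)=f(y)$. For a linear order $(X,\le_X)$ (with $0$ its least element), $X^\omega$ is the set of finite sequences $\langle (b_0,a_0),\dots,(b_n,a_n)\rangle$ with $b_i\in\mathbb N$, $b_0>\dots>b_n$, $a_i\in X\setminus\{0\}$, ordered lexicographically: proper extensions are larger; otherwise at the first differing position $j$, $\sigma>\tau$ iff $b_j>b'_j$, or $b_j=b'_j$ and $a_j>_Xa'_j$. A sequence $\sigma'$ in $X$ is contained in a sequence $\sigma$ in $X^\omega$ if each $\sigma'_i$ is an entry $a_k$ of some term $\sigma_{t_i}$ with $t_i\le t_j$ for $i<j$. $\mathsf{WOP}(X\mapsto X^\omega)$: instance is a linear order $X$ with an infinite decreasing sequence $\sigma$ in $X^\omega$; solutions are infinite decreasing sequences in $X$ contained in $\sigma$. -}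

module Defs where

open import Data.Nat using (ℕ; zero; suc; _+_; _*_; _∸_; _^_; _≤_; _<_)
open import Data.Fin using (Fin)
open import Data.Vec using (Vec; []; _∷_; lookup)
open import Data.Maybe using (Maybe; just; nothing; _>>=_)
import Data.Maybe as M
open import Data.List using (List; []; _∷_; map; upTo)
open import Data.List.Relation.Unary.All using (All)
open import Data.Product using (Σ; ∃; _×_; _,_; proj₁; proj₂)
open import Data.Sum using (_⊎_)
open import Data.Unit using (⊤)
open import Data.Empty using (⊥)
open import Relation.Binary.PropositionalEquality using (_≡_; _≢_)

-- Oracle computation: mu-recursive functions relative to an oracle
-- A : ℕ → ℕ (a standard model of Turing functionals).

data Code : ℕ → Set where
  zer  : ∀ {k} → Code k
  sucC : Code 1
  proj : ∀ {k} → Fin k → Code k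
  orc  : Code 1
  comp : ∀ {m k} → Code m → Vec (Code k) m → Code k
  prec : ∀ {k} → Code k → Code (2 + k) → Code (suc k)
  mu   : ∀ {k} → Code (suc k) → Code k

Oracle : Set
Oracle = ℕ → ℕ

mutual
  -- step-indexed evaluation; a 'just' result is always the true value
  eval : ∀ {k} → ℕ → Code k → Oracle → Vec ℕ k → Maybe ℕ
  eval zero    _           _ _               = nothing
  eval (suc f) zer         A xs              = just 0
  eval (suc f) sucC        A (x ∷ [])        = just (suc x)
  eval (suc f) (proj i)    A xs              = just (lookup xs i)
  eval (suc f) orc         A (x ∷ [])        = just (A x)
  eval (suc f) (comp g hs) A xs              =
    evalVec f hs A xs >>= λ ys → eval f g A ys
  eval (suc f) (prec g h)  A (zero ∷ xs)     = eval f g A xs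
  eval (suc f) (prec g h)  A (suc n ∷ xs)    =
    eval f (prec g h) A (n ∷ xs) >>= λ r → eval f h A (n ∷ r ∷ xs)
  eval (suc f) (mu g)      A xs              = search f g A xs 0

  evalVec : ∀ {k m} → ℕ → Vec (Code k) m → Oracle → Vec ℕ k → Maybe (Vec ℕ m)
  evalVec f []       A xs = just []
  evalVec f (h ∷ hs) A xs =
    eval f h A xs >>= λ y → M.map (y ∷_) (evalVec f hs A xs)

  search : ∀ {k} → ℕ → Code (suc k) → Oracle → Vec ℕ k → ℕ → Maybe ℕ
  search zero    g A xs i = nothing
  search (suc f) g A xs i =
    eval f g A (i ∷ xs) >>= λ r → ifZero r i (search f g A xs (suc i))

  ifZero : ℕ → ℕ → Maybe ℕ → Maybe ℕ
  ifZero zero    i _ = just i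
  ifZero (suc _) _ m = m

Converges : Code 1 → Oracle → ℕ → ℕ → Set
Converges c A x y = ∃ λ fuel → eval fuel c A (x ∷ []) ≡ just y

Computes : Code 1 → Oracle → Oracle → Set
Computes c A F = ∀ x → Converges c A x (F x)

-- effective join A ⊕ B : (A ⊕ B)(2n) = A n, (A ⊕ B)(2n+1) = B n
_⊕_ : Oracle → Oracle → Oracle
(A ⊕ B) zero          = A 0
(A ⊕ B) (suc zero)    = B 0
(A ⊕ B) (suc (suc n)) = ((λ m → A (suc m)) ⊕ (λ m → B (suc m))) n

pair : ℕ → ℕ → ℕ
pair x y = 2 ^ x * (2 * y + 1) ∸ 1

record Problem : Set₁ where
  field
    Inst : Oracle → Set
    Sol  : Oracle → Oracle → Set
open Problem public

_≤W_ : Problem → Problem → Set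
P ≤W Q = Σ (Code 1) λ H → Σ (Code 1) λ K →
  ∀ X → Inst P X →
    Σ Oracle λ HX → Computes H X HX × Inst Q HX ×
      (∀ Ŷ → Sol Q HX Ŷ →
        Σ Oracle λ Z → Computes K (X ⊕ Ŷ) Z × Sol P X Z)

-- ECT.  A name g codes the pair (n , f) by n = g 0 and f x = g (suc x).
-- A solution b is named by any function h with h 0 = b.

ECT : Problem
ECT = record
  { Inst = λ g → ∀ x → g (suc x) < g 0
  ; Sol  = λ g h → ∀ x → h 0 < x → ∃ λ y → x < y × g (suc y) ≡ g (suc x)
  }

Entry : Set
Entry = ℕ × ℕ      -- (b , a)

BDecr : List Entry → Set
BDecr []                = ⊤
BDecr (p ∷ [])          = ⊤
BDecr (p ∷ q ∷ l)       = proj₁ q < proj₁ p × BDecr (q ∷ l)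

InXω : (ℕ → Set) → List Entry → Set
InXω mem σ = BDecr σ × All (λ p → mem (proj₂ p) × proj₂ p ≢ 0) σ

LexLt : (ℕ → ℕ → Set) → List Entry → List Entry → Set
LexLt lt []             (_ ∷ _)         = ⊤
LexLt lt _              []              = ⊥
LexLt lt ((b , a) ∷ τ)  ((b' , a') ∷ σ) =
  b < b' ⊎ (b ≡ b' × (lt a a' ⊎ (a ≡ a' × LexLt lt τ σ)))

-- A name w codes
--   x ∈ X          iff  w (pair 0 x) ≡ 1
--   x ≤_X y        iff  w (pair 1 (pair x y)) ≡ 1
--   length of σ_t   =   w (pair 2 t)
--   σ_t = ⟨(b_0,a_0),…⟩ with b_i = w (pair 3 (pair t i)), a_i = w (pair 4 (pair t i))

memX : Oracle → ℕ → Set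
memX w x = w (pair 0 x) ≡ 1

leX : Oracle → ℕ → ℕ → Set
leX w x y = w (pair 1 (pair x y)) ≡ 1

ltX : Oracle → ℕ → ℕ → Set
ltX w x y = leX w x y × x ≢ y

lenσ : Oracle → ℕ → ℕ
lenσ w t = w (pair 2 t)

bσ aσ : Oracle → ℕ → ℕ → ℕ
bσ w t i = w (pair 3 (pair t i))
aσ w t i = w (pair 4 (pair t i))

σ : Oracle → ℕ → List Entry
σ w t = map (λ i → (bσ w t i , aσ w t i)) (upTo (lenσ w t))

record IsLinOrd0 (w : Oracle) : Set where
  field
    field⊆   : ∀ x y → leX w x y → memX w x × memX w y
    refl     : ∀ x → memX w x → leX w x x
    antisym  : ∀ x y → leX w x y → leX w y x → x ≡ y
    trans    : ∀ x y z → leX w x y → leX w y z → leX w x z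
    total    : ∀ x y → memX w x → memX w y → leX w x y ⊎ leX w y x
    zero∈    : memX w 0
    zeroLeast : ∀ x → memX w x → leX w 0 x

WOPω : Problem
WOPω = record
  { Inst = λ w → IsLinOrd0 w
               × (∀ t → InXω (memX w) (σ w t))
               × (∀ t → LexLt (ltX w) (σ w (suc t)) (σ w t))
  ; Sol  = λ w s → (∀ i → memX w (s i))
               × (∀ i → ltX w (s (suc i)) (s i))
               × Σ (ℕ → ℕ) λ τ → (∀ i j → i < j → τ i ≤ τ j)
                   × (∀ i → ∃ λ k → k < lenσ w (τ i) × aσ w (τ i) k ≡ s i)
  }

-- Given n colours and f, call a slot live at stage t if it records, for some colour, the
-- last time x < t at which f takes it (or a placeholder while the colour is unused).  There
-- are always n live slots p₁ < … < pₙ; with p₀ = 0 the t-th term of σ is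
-- ⟨(n-1, p₀ ⊲ p₁), …, (0, pₙ₋₁ ⊲ pₙ)⟩, the points q ⊲ a of X being ordered by q ascending and
-- then a descending.  Passing to stage t+1 replaces the slot of colour f t by a new largest
-- slot: the entries before it are kept and the one ending at it grows its second component,
-- so σ descends.  Conversely a descending sequence s in X taken from σ consists of points
-- pₖ ⊲ pₖ₊₁.  If some x > s 0 never repeated its colour, the slot of x would stay live and
-- bound all second components, but strictly descending points with bounded second
-- components cannot go on for ever.  So b = s 0 solves the instance of ECT.  All maps
-- involved are bounded-sum arithmetic in the oracle and therefore compile to codes.

module Submission where

open import Defs
open import Data.Nat
open import Data.Nat.Properties
open import Data.Nat.Induction using (<-rec)
open import Data.Fin using (Fin; zero; suc)
open import Data.Vec using (Vec; []; _∷_; lookup; tabulate)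
open import Data.Maybe using (just; _>>=_)
import Data.Maybe as Maybe
open import Data.List using ([]; _∷_; applyUpTo)
open import Data.List.Properties using (map-applyUpTo)
open import Data.List.Relation.Unary.All.Properties using (applyUpTo⁺₁)
import Data.Product
open import Data.Product using (∃; ∃₂; _×_; _,_; proj₁; proj₂)
import Data.Sum
open import Data.Sum using (_⊎_; inj₁; inj₂; [_,_]′)
open import Data.Unit using (tt)
open import Data.Empty using (⊥; ⊥-elim)
open import Function using (_∘_; id)
open import Relation.Nullary using (¬_; yes; no)
open import Relation.Binary.PropositionalEquality
open import Relation.Binary.Definitions using (tri<; tri≈; tri>)

-- Arithmetic expressions with oracle access, and their compilation to codes

∑< : ℕ → (ℕ → ℕ) → ℕ
∑< zero    F = 0
∑< (suc n) F = ∑< n F + F n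

isZero isNonZero : ℕ → ℕ
isZero zero    = 1
isZero (suc _) = 0
isNonZero zero    = 0
isNonZero (suc _) = 1

infixl 6 _+ᴱ_ _∸ᴱ_
infixl 7 _*ᴱ_

data Expr : ℕ → Set where
  var                 : ∀ {k} → Fin k → Expr k
  lit                 : ∀ {k} → ℕ → Expr k
  oracle              : ∀ {k} → Expr k → Expr k
  _+ᴱ_ _∸ᴱ_ _*ᴱ_      : ∀ {k} → Expr k → Expr k → Expr k
  2^ᴱ isZeroᴱ isNonZeroᴱ : ∀ {k} → Expr k → Expr k
  ∑<ᴱ                 : ∀ {k} → Expr k → Expr (suc k) → Expr k
  _∘ᴱ_                : ∀ {k m} → Expr m → Vec (Expr k) m → Expr k

mutual
  ⟦_⟧ : ∀ {k} → Expr k → Oracle → Vec ℕ k → ℕ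
  ⟦ var i ⟧        A xs = lookup xs i
  ⟦ lit c ⟧        A xs = c
  ⟦ oracle e ⟧     A xs = A (⟦ e ⟧ A xs)
  ⟦ a +ᴱ b ⟧       A xs = ⟦ a ⟧ A xs + ⟦ b ⟧ A xs
  ⟦ a ∸ᴱ b ⟧       A xs = ⟦ a ⟧ A xs ∸ ⟦ b ⟧ A xs
  ⟦ a *ᴱ b ⟧       A xs = ⟦ a ⟧ A xs * ⟦ b ⟧ A xs
  ⟦ 2^ᴱ e ⟧        A xs = 2 ^ ⟦ e ⟧ A xs
  ⟦ isZeroᴱ e ⟧    A xs = isZero (⟦ e ⟧ A xs)
  ⟦ isNonZeroᴱ e ⟧ A xs = isNonZero (⟦ e ⟧ A xs)
  ⟦ ∑<ᴱ B b ⟧      A xs = ∑< (⟦ B ⟧ A xs) (λ i → ⟦ b ⟧ A (i ∷ xs))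
  ⟦ e ∘ᴱ es ⟧      A xs = ⟦ e ⟧ A (⟦ es ⟧* A xs)

  ⟦_⟧* : ∀ {k m} → Vec (Expr k) m → Oracle → Vec ℕ k → Vec ℕ m
  ⟦ [] ⟧*     A xs = []
  ⟦ e ∷ es ⟧* A xs = ⟦ e ⟧ A xs ∷ ⟦ es ⟧* A xs

constCode : ∀ {k} → ℕ → Code k
constCode zero    = zer
constCode (suc c) = comp sucC (constCode c ∷ [])

addCode : Code 2
addCode = prec (proj zero) (comp sucC (proj (suc zero) ∷ []))

predCode : Code 1
predCode = prec zer (proj zero)

monusCode : Code 2
monusCode = prec (proj zero) (comp predCode (proj (suc zero) ∷ []))

mulCode : Code 2
mulCode = prec zer (comp addCode (proj (suc (suc zero)) ∷ proj (suc zero) ∷ []))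

pow2Code : Code 1
pow2Code = prec (constCode 1) (comp mulCode (constCode 2 ∷ proj (suc zero) ∷ []))

isZeroCode : Code 1
isZeroCode = prec (constCode 1) zer

isNonZeroCode : Code 1
isNonZeroCode = prec zer (constCode 1)

sumCode : ∀ {k} → Code k → Code (suc k) → Code k
sumCode {k} cB cb = comp (prec zer step) (cB ∷ tabulate proj)
  where
  step : Code (2 + k)
  step = comp addCode (proj (suc zero) ∷ comp cb (proj zero ∷ tabulate (λ i → proj (suc (suc i)))) ∷ [])

mutual
  compile : ∀ {k} → Expr k → Code k
  compile (var i)        = proj i
  compile (lit c)        = constCode c
  compile (oracle e)     = comp orc (compile e ∷ [])
  compile (a +ᴱ b)       = comp addCode (compile a ∷ compile b ∷ [])
  compile (a ∸ᴱ b)       = comp monusCode (compile b ∷ compile a ∷ [])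
  compile (a *ᴱ b)       = comp mulCode (compile a ∷ compile b ∷ [])
  compile (2^ᴱ e)        = comp pow2Code (compile e ∷ [])
  compile (isZeroᴱ e)    = comp isZeroCode (compile e ∷ [])
  compile (isNonZeroᴱ e) = comp isNonZeroCode (compile e ∷ [])
  compile (∑<ᴱ B b)      = sumCode (compile B) (compile b)
  compile (e ∘ᴱ es)      = comp (compile e) (compile* es)

  compile* : ∀ {k m} → Vec (Expr k) m → Vec (Code k) m
  compile* []       = []
  compile* (e ∷ es) = compile e ∷ compile* es

-- Evaluation with a fuel threshold beyond which the result is stable; this
-- monotonicity is what lets the fuel of subcomputations be combined by ⊔.
record Evaluates {k} (c : Code k) (A : Oracle) (xs : Vec ℕ k) (y : ℕ) : Set where
  constructor _,_
  field
    fuel   : ℕ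
    stable : ∀ f → fuel ≤ f → eval f c A xs ≡ just y

record EvaluatesAll {k m} (cs : Vec (Code k) m) (A : Oracle) (xs : Vec ℕ k) (ys : Vec ℕ m) : Set where
  constructor _,_
  field
    fuel   : ℕ
    stable : ∀ f → fuel ≤ f → evalVec f cs A xs ≡ just ys

evaluates-proj : ∀ {k} (i : Fin k) A xs → Evaluates (proj i) A xs (lookup xs i)
evaluates-proj i A xs = 1 , λ { (suc f) _ → refl }

evaluates-zer : ∀ {k} A (xs : Vec ℕ k) → Evaluates zer A xs 0
evaluates-zer A xs = 1 , λ { (suc f) _ → refl }

evaluates-suc : ∀ A x → Evaluates sucC A (x ∷ []) (suc x)
evaluates-suc A x = 1 , λ { (suc f) _ → refl }

evaluates-orc : ∀ A x → Evaluates orc A (x ∷ []) (A x)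
evaluates-orc A x = 1 , λ { (suc f) _ → refl }

evaluatesAll-[] : ∀ {k} A (xs : Vec ℕ k) → EvaluatesAll [] A xs []
evaluatesAll-[] A xs = 0 , λ f _ → refl

evaluatesAll-∷ : ∀ {k m} {h : Code k} {hs : Vec (Code k) m} {A xs y ys} →
  Evaluates h A xs y → EvaluatesAll hs A xs ys → EvaluatesAll (h ∷ hs) A xs (y ∷ ys)
evaluatesAll-∷ {hs = hs} {A} {xs} {y} (F₁ , p₁) (F₂ , p₂) = F₁ ⊔ F₂ , λ f F≤f →
  trans (cong (_>>= λ y′ → Maybe.map (y′ ∷_) (evalVec f hs A xs)) (p₁ f (m⊔n≤o⇒m≤o F₁ F₂ F≤f)))
        (cong (Maybe.map (y ∷_)) (p₂ f (m⊔n≤o⇒n≤o F₁ F₂ F≤f)))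

evaluates-comp : ∀ {k m} {g : Code m} {hs : Vec (Code k) m} {A xs ys y} →
  EvaluatesAll hs A xs ys → Evaluates g A ys y → Evaluates (comp g hs) A xs y
evaluates-comp {g = g} {A = A} (F₁ , p₁) (F₂ , p₂) = suc (F₁ ⊔ F₂) , λ
  { (suc f) (s≤s F≤f) → trans (cong (_>>= eval f g A) (p₁ f (m⊔n≤o⇒m≤o F₁ F₂ F≤f)))
                              (p₂ f (m⊔n≤o⇒n≤o F₁ F₂ F≤f)) }

evaluates-prec : ∀ {k} {g : Code k} {h : Code (2 + k)} {A xs} (P : ℕ → ℕ) →
  Evaluates g A xs (P 0) → (∀ m → Evaluates h A (m ∷ P m ∷ xs) (P (suc m))) →
  ∀ n → Evaluates (prec g h) A (n ∷ xs) (P n)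
evaluates-prec P (F , p) step zero = suc F , λ { (suc f) (s≤s F≤f) → p f F≤f }
evaluates-prec {h = h} {A} {xs} P base step (suc n)
  with evaluates-prec P base step n | step n
... | F₁ , p₁ | F₂ , p₂ = suc (F₁ ⊔ F₂) , λ
  { (suc f) (s≤s F≤f) →
      trans (cong (_>>= λ r → eval f h A (n ∷ r ∷ xs)) (p₁ f (m⊔n≤o⇒m≤o F₁ F₂ F≤f)))
            (p₂ f (m⊔n≤o⇒n≤o F₁ F₂ F≤f)) }

evaluates-unary : ∀ {k} {g : Code 1} {h : Code k} {A xs x y} →
  Evaluates h A xs x → Evaluates g A (x ∷ []) y → Evaluates (comp g (h ∷ [])) A xs y
evaluates-unary {A = A} {xs} eh eg = evaluates-comp (evaluatesAll-∷ eh (evaluatesAll-[] A xs)) eg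

evaluates-binary : ∀ {k} {g : Code 2} {h₁ h₂ : Code k} {A xs x₁ x₂ y} →
  Evaluates h₁ A xs x₁ → Evaluates h₂ A xs x₂ → Evaluates g A (x₁ ∷ x₂ ∷ []) y →
  Evaluates (comp g (h₁ ∷ h₂ ∷ [])) A xs y
evaluates-binary {A = A} {xs} e₁ e₂ eg =
  evaluates-comp (evaluatesAll-∷ e₁ (evaluatesAll-∷ e₂ (evaluatesAll-[] A xs))) eg

evaluates-const : ∀ {k} c A (xs : Vec ℕ k) → Evaluates (constCode c) A xs c
evaluates-const zero    A xs = evaluates-zer A xs
evaluates-const (suc c) A xs = evaluates-unary (evaluates-const c A xs) (evaluates-suc A c)

evaluates-add : ∀ A x y → Evaluates addCode A (x ∷ y ∷ []) (x + y)
evaluates-add A x y = evaluates-prec (_+ y) (evaluates-proj zero A (y ∷ []))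
  (λ m → evaluates-unary (evaluates-proj (suc zero) A _) (evaluates-suc A (m + y))) x

evaluates-pred : ∀ A x → Evaluates predCode A (x ∷ []) (pred x)
evaluates-pred A x = evaluates-prec pred (evaluates-zer A []) (λ m → evaluates-proj zero A _) x

evaluates-monus : ∀ A x y → Evaluates monusCode A (y ∷ x ∷ []) (x ∸ y)
evaluates-monus A x y = evaluates-prec (x ∸_) (evaluates-proj zero A (x ∷ []))
  (λ m → subst (Evaluates _ A _) (pred[m∸n]≡m∸[1+n] x m)
           (evaluates-unary (evaluates-proj (suc zero) A _) (evaluates-pred A (x ∸ m)))) y

evaluates-mul : ∀ A x y → Evaluates mulCode A (x ∷ y ∷ []) (x * y)
evaluates-mul A x y = evaluates-prec (_* y) (evaluates-zer A (y ∷ []))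
  (λ m → evaluates-binary (evaluates-proj _ A _) (evaluates-proj _ A _) (evaluates-add A y (m * y))) x

evaluates-pow2 : ∀ A x → Evaluates pow2Code A (x ∷ []) (2 ^ x)
evaluates-pow2 A x = evaluates-prec (2 ^_) (evaluates-const 1 A [])
  (λ m → evaluates-binary (evaluates-const 2 A _) (evaluates-proj _ A _) (evaluates-mul A 2 (2 ^ m))) x

evaluates-isZero : ∀ A x → Evaluates isZeroCode A (x ∷ []) (isZero x)
evaluates-isZero A x = evaluates-prec isZero (evaluates-const 1 A []) (λ m → evaluates-zer A _) x

evaluates-isNonZero : ∀ A x → Evaluates isNonZeroCode A (x ∷ []) (isNonZero x)
evaluates-isNonZero A x = evaluates-prec isNonZero (evaluates-zer A []) (λ m → evaluates-const 1 A _) x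

evaluatesAll-projs : ∀ {k m} (ρ : Fin k → Fin m) A (zs : Vec ℕ m) (ys : Vec ℕ k) →
  (∀ i → lookup zs (ρ i) ≡ lookup ys i) → EvaluatesAll (tabulate (λ i → proj (ρ i))) A zs ys
evaluatesAll-projs ρ A zs []       hyp = evaluatesAll-[] A zs
evaluatesAll-projs ρ A zs (y ∷ ys) hyp =
  evaluatesAll-∷ (subst (Evaluates _ A zs) (hyp zero) (evaluates-proj (ρ zero) A zs))
                 (evaluatesAll-projs (λ i → ρ (suc i)) A zs ys (λ i → hyp (suc i)))

evaluates-sum : ∀ {k} {cB : Code k} {cb : Code (suc k)} {A xs} B (b : ℕ → ℕ) →
  Evaluates cB A xs B → (∀ i → Evaluates cb A (i ∷ xs) (b i)) →
  Evaluates (sumCode cB cb) A xs (∑< B b)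
evaluates-sum {A = A} {xs} B b eB eb =
  evaluates-comp (evaluatesAll-∷ eB (evaluatesAll-projs (λ i → i) A xs xs (λ i → refl)))
    (evaluates-prec (λ m → ∑< m b) (evaluates-zer A xs) step B)
  where
  step : ∀ m → Evaluates _ A (m ∷ ∑< m b ∷ xs) (∑< (suc m) b)
  step m = evaluates-binary (evaluates-proj (suc zero) A _)
    (evaluates-comp (evaluatesAll-∷ (evaluates-proj zero A _)
                                    (evaluatesAll-projs (λ i → suc (suc i)) A _ xs (λ i → refl)))
                    (eb m))
    (evaluates-add A _ _)

mutual
  evaluates-compile : ∀ {k} (e : Expr k) A xs → Evaluates (compile e) A xs (⟦ e ⟧ A xs)
  evaluates-compile (var i)        A xs = evaluates-proj i A xs
  evaluates-compile (lit c)        A xs = evaluates-const c A xs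
  evaluates-compile (oracle e)     A xs = evaluates-unary (evaluates-compile e A xs) (evaluates-orc A _)
  evaluates-compile (a +ᴱ b)       A xs =
    evaluates-binary (evaluates-compile a A xs) (evaluates-compile b A xs) (evaluates-add A _ _)
  evaluates-compile (a ∸ᴱ b)       A xs =
    evaluates-binary (evaluates-compile b A xs) (evaluates-compile a A xs) (evaluates-monus A _ _)
  evaluates-compile (a *ᴱ b)       A xs =
    evaluates-binary (evaluates-compile a A xs) (evaluates-compile b A xs) (evaluates-mul A _ _)
  evaluates-compile (2^ᴱ e)        A xs = evaluates-unary (evaluates-compile e A xs) (evaluates-pow2 A _)
  evaluates-compile (isZeroᴱ e)    A xs = evaluates-unary (evaluates-compile e A xs) (evaluates-isZero A _)
  evaluates-compile (isNonZeroᴱ e) A xs =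
    evaluates-unary (evaluates-compile e A xs) (evaluates-isNonZero A _)
  evaluates-compile (∑<ᴱ B b)      A xs =
    evaluates-sum _ _ (evaluates-compile B A xs) (λ i → evaluates-compile b A (i ∷ xs))
  evaluates-compile (e ∘ᴱ es)      A xs =
    evaluates-comp (evaluatesAll-compile es A xs) (evaluates-compile e A _)

  evaluatesAll-compile : ∀ {k m} (es : Vec (Expr k) m) A xs →
    EvaluatesAll (compile* es) A xs (⟦ es ⟧* A xs)
  evaluatesAll-compile []       A xs = evaluatesAll-[] A xs
  evaluatesAll-compile (e ∷ es) A xs =
    evaluatesAll-∷ (evaluates-compile e A xs) (evaluatesAll-compile es A xs)

compile-computes : (e : Expr 1) (A : Oracle) → Computes (compile e) A (λ x → ⟦ e ⟧ A (x ∷ []))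
compile-computes e A x = fuel , stable fuel ≤-refl
  where open Evaluates (evaluates-compile e A (x ∷ []))

eqTest ltTest leTest : ℕ → ℕ → ℕ
eqTest x y = isZero ((x ∸ y) + (y ∸ x))
ltTest x y = isNonZero (y ∸ x)
leTest x y = isZero (x ∸ y)

isZero-≢0 : ∀ {x} → x ≢ 0 → isZero x ≡ 0
isZero-≢0 {zero}  x≢0 = ⊥-elim (x≢0 refl)
isZero-≢0 {suc x} x≢0 = refl

eqTest-refl : ∀ x → eqTest x x ≡ 1
eqTest-refl zero    = refl
eqTest-refl (suc x) = eqTest-refl x

eqTest-≢ : ∀ {x y} → x ≢ y → eqTest x y ≡ 0
eqTest-≢ {zero}  {zero}  x≢y = ⊥-elim (x≢y refl)
eqTest-≢ {zero}  {suc y} x≢y = refl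
eqTest-≢ {suc x} {zero}  x≢y = refl
eqTest-≢ {suc x} {suc y} x≢y = eqTest-≢ (x≢y ∘ cong suc)

ltTest-< : ∀ {x y} → x < y → ltTest x y ≡ 1
ltTest-< {zero}  {suc y} _         = refl
ltTest-< {suc x} {suc y} (s≤s x<y) = ltTest-< x<y

ltTest-≥ : ∀ {x y} → y ≤ x → ltTest x y ≡ 0
ltTest-≥ {x}     {zero}  _         = cong isNonZero (0∸n≡0 x)
ltTest-≥ {suc x} {suc y} (s≤s y≤x) = ltTest-≥ y≤x

ltTest≤1 : ∀ x y → ltTest x y ≤ 1
ltTest≤1 x y with y ∸ x
... | zero  = z≤n
... | suc _ = ≤-refl

leTest-≤ : ∀ {x y} → x ≤ y → leTest x y ≡ 1
leTest-≤ {zero}  {y}     _         = cong isZero (0∸n≡0 y)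
leTest-≤ {suc x} {suc y} (s≤s x≤y) = leTest-≤ x≤y

leTest-> : ∀ {x y} → y < x → leTest x y ≡ 0
leTest-> {suc x} {zero}  _         = refl
leTest-> {suc x} {suc y} (s≤s y<x) = leTest-> y<x

leTest≡1⇒≤ : ∀ x y → leTest x y ≡ 1 → x ≤ y
leTest≡1⇒≤ zero    y       _  = z≤n
leTest≡1⇒≤ (suc x) (suc y) eq = s≤s (leTest≡1⇒≤ x y eq)

∑<-cong : ∀ B {F G : ℕ → ℕ} → (∀ v → v < B → F v ≡ G v) → ∑< B F ≡ ∑< B G
∑<-cong zero    F≗G = refl
∑<-cong (suc B) F≗G = cong₂ _+_ (∑<-cong B (λ v v<B → F≗G v (m<n⇒m<1+n v<B))) (F≗G B ≤-refl)

∑<-zero : ∀ B {F : ℕ → ℕ} → (∀ v → v < B → F v ≡ 0) → ∑< B F ≡ 0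
∑<-zero zero    F≗0 = refl
∑<-zero (suc B) F≗0 = cong₂ _+_ (∑<-zero B (λ v v<B → F≗0 v (m<n⇒m<1+n v<B))) (F≗0 B ≤-refl)

∑<-ones : ∀ q {F : ℕ → ℕ} → (∀ v → v < q → F v ≡ 1) → ∑< q F ≡ q
∑<-ones zero    F≗1 = refl
∑<-ones (suc q) F≗1 =
  trans (cong₂ _+_ (∑<-ones q (λ v v<q → F≗1 v (m<n⇒m<1+n v<q))) (F≗1 q ≤-refl)) (+-comm q 1)

∑<-single : ∀ B {F : ℕ → ℕ} {j} → j < B → (∀ v → v < B → v ≢ j → F v ≡ 0) → ∑< B F ≡ F j
∑<-single (suc B) {F} j<1+B F≗0 with m<1+n⇒m<n∨m≡n j<1+B
... | inj₂ refl = cong (_+ F B) (∑<-zero B (λ v v<B → F≗0 v (m<n⇒m<1+n v<B) (<⇒≢ v<B)))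
... | inj₁ j<B  = trans (cong₂ _+_ (∑<-single B j<B (λ v v<B → F≗0 v (m<n⇒m<1+n v<B)))
                                   (F≗0 B ≤-refl (≢-sym (<⇒≢ j<B))))
                        (+-identityʳ _)

∑<-mono : ∀ F {B B′} → B ≤ B′ → ∑< B F ≤ ∑< B′ F
∑<-mono F {B′ = zero}   z≤n    = ≤-refl
∑<-mono F {B′ = suc B′} B≤1+B′ with m≤n⇒m<n∨m≡n B≤1+B′
... | inj₂ refl   = ≤-refl
... | inj₁ B<1+B′ = ≤-trans (∑<-mono F (m<1+n⇒m≤n B<1+B′)) (m≤m+n _ _)

∑<-≥ : ∀ F {B q} → q ≤ B → (∀ v → v < q → F v ≡ 1) → q ≤ ∑< B F
∑<-≥ F {B} q≤B F≗1 = subst (_≤ ∑< B F) (∑<-ones _ F≗1) (∑<-mono F q≤B)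

∑<-≤ : ∀ B {F : ℕ → ℕ} {p} → (∀ v → F v ≤ 1) → (∀ v → p ≤ v → v < B → F v ≡ 0) → ∑< B F ≤ p
∑<-≤ zero            F≤1 F≗0 = z≤n
∑<-≤ (suc B) {F} {p} F≤1 F≗0 with p ≤? B
... | yes p≤B = begin
    ∑< B F + F B  ≡⟨ cong (∑< B F +_) (F≗0 B p≤B ≤-refl) ⟩
    ∑< B F + 0    ≡⟨ +-identityʳ _ ⟩
    ∑< B F        ≤⟨ ∑<-≤ B F≤1 (λ v p≤v v<B → F≗0 v p≤v (m<n⇒m<1+n v<B)) ⟩
    p             ∎
  where open ≤-Reasoning
... | no p≰B = begin
    ∑< B F + F B  ≤⟨ +-mono-≤ (∑<-≤ B F≤1 (λ v B≤v v<B → ⊥-elim (<⇒≱ v<B B≤v))) (F≤1 B) ⟩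
    B + 1         ≡⟨ +-comm B 1 ⟩
    suc B         ≤⟨ ≰⇒> p≰B ⟩
    p             ∎
  where open ≤-Reasoning

term≤∑< : ∀ B {F : ℕ → ℕ} {v} → v < B → F v ≤ ∑< B F
term≤∑< (suc B) {F} v<1+B with m<1+n⇒m<n∨m≡n v<1+B
... | inj₂ refl = m≤n+m (F B) (∑< B F)
... | inj₁ v<B  = ≤-trans (term≤∑< B v<B) (m≤m+n _ _)

∑<-witness : ∀ B {F : ℕ → ℕ} → ∑< B F ≢ 0 → ∃ λ v → v < B × F v ≢ 0
∑<-witness zero          ∑≢0 = ⊥-elim (∑≢0 refl)
∑<-witness (suc B) {F} ∑≢0 with F B ≟ 0
... | no FB≢0 = B , ≤-refl , FB≢0
... | yes FB≡0 with ∑<-witness B (λ ∑≡0 → ∑≢0 (cong₂ _+_ ∑≡0 FB≡0))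
...   | v , v<B , Fv≢0 = v , m<n⇒m<1+n v<B , Fv≢0

∑<-remove : ∀ B {F G : ℕ → ℕ} {u} → u < B → F u ≡ 1 → G u ≡ 0 →
  (∀ v → v < B → v ≢ u → G v ≡ F v) → ∑< B F ≡ suc (∑< B G)
∑<-remove (suc B) {F} {G} u<1+B Fu≡1 Gu≡0 G≗F with m<1+n⇒m<n∨m≡n u<1+B
... | inj₂ refl = begin
    ∑< B F + F B        ≡⟨ cong₂ _+_ (∑<-cong B (λ v v<B → sym (G≗F v (m<n⇒m<1+n v<B) (<⇒≢ v<B))))
                                     Fu≡1 ⟩
    ∑< B G + 1          ≡⟨ +-comm _ 1 ⟩
    suc (∑< B G)        ≡⟨ cong suc (sym (+-identityʳ _)) ⟩
    suc (∑< B G + 0)    ≡⟨ cong (λ z → suc (∑< B G + z)) (sym Gu≡0) ⟩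
    suc (∑< B G + G B)  ∎
  where open ≡-Reasoning
... | inj₁ u<B =
  cong₂ _+_ (∑<-remove B u<B Fu≡1 Gu≡0 (λ v v<B → G≗F v (m<n⇒m<1+n v<B)))
            (sym (G≗F B ≤-refl (≢-sym (<⇒≢ u<B))))

-- The pairing function

pow2TimesOdd : ℕ → ℕ → ℕ
pow2TimesOdd a b = 2 ^ a * (2 * b + 1)

twice : ∀ m → 2 * m ≡ m + m
twice m = cong (m +_) (+-identityʳ m)

odd-unfold : ∀ m → 2 * m + 1 ≡ suc (m + m)
odd-unfold m = trans (+-comm (2 * m) 1) (cong suc (twice m))

double-injective : ∀ {m n} → m + m ≡ n + n → m ≡ n
double-injective {m} {n} eq = *-cancelˡ-≡ m n 2 (trans (twice m) (trans eq (sym (twice n))))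

odd≢even : ∀ m n → suc (m + m) ≢ n + n
odd≢even zero    zero    ()
odd≢even zero    (suc n) eq = 0≢1+n (suc-injective (trans eq (+-suc (suc n) n)))
odd≢even (suc m) zero    ()
odd≢even (suc m) (suc n) eq =
  odd≢even m n (suc-injective (suc-injective (trans (sym (cong suc (+-suc (suc m) m)))
                                                   (trans eq (+-suc (suc n) n)))))

pow2TimesOdd-zero : ∀ b → pow2TimesOdd 0 b ≡ suc (b + b)
pow2TimesOdd-zero b = trans (*-identityˡ (2 * b + 1)) (odd-unfold b)

pow2TimesOdd-suc : ∀ a b → pow2TimesOdd (suc a) b ≡ pow2TimesOdd a b + pow2TimesOdd a b
pow2TimesOdd-suc a b = trans (*-assoc 2 (2 ^ a) (2 * b + 1)) (twice (pow2TimesOdd a b))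

pow2TimesOdd-injective : ∀ {a b a′ b′} → pow2TimesOdd a b ≡ pow2TimesOdd a′ b′ → a ≡ a′ × b ≡ b′
pow2TimesOdd-injective {zero} {b} {zero} {b′} eq = refl , double-injective
  (suc-injective (trans (sym (pow2TimesOdd-zero b)) (trans eq (pow2TimesOdd-zero b′))))
pow2TimesOdd-injective {zero} {b} {suc a′} {b′} eq = ⊥-elim (odd≢even b (pow2TimesOdd a′ b′)
  (trans (sym (pow2TimesOdd-zero b)) (trans eq (pow2TimesOdd-suc a′ b′))))
pow2TimesOdd-injective {suc a} {b} {zero} {b′} eq = ⊥-elim (odd≢even b′ (pow2TimesOdd a b)
  (trans (sym (pow2TimesOdd-zero b′)) (trans (sym eq) (pow2TimesOdd-suc a b))))
pow2TimesOdd-injective {suc a} {b} {suc a′} {b′} eq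
  with pow2TimesOdd-injective {a} {b} {a′} {b′}
         (double-injective (trans (sym (pow2TimesOdd-suc a b)) (trans eq (pow2TimesOdd-suc a′ b′))))
... | refl , refl = refl , refl

pow2TimesOdd>0 : ∀ a b → 0 < pow2TimesOdd a b
pow2TimesOdd>0 a b = *-mono-≤ (m^n>0 2 a) (m≤n+m 1 (2 * b))

halve : ∀ k → ∃ λ h → k ≡ h + h ⊎ k ≡ suc (h + h)
halve zero = 0 , inj₁ refl
halve (suc k) with halve k
... | h , inj₁ eq = h , inj₂ (cong suc eq)
... | h , inj₂ eq = suc h , inj₁ (cong suc (trans eq (sym (+-suc h h))))

pow2TimesOdd-surjective : ∀ m → ∃₂ λ a b → pow2TimesOdd a b ≡ suc m
pow2TimesOdd-surjective = <-rec _ split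
  where
  split : ∀ m → (∀ {k} → k < m → ∃₂ λ a b → pow2TimesOdd a b ≡ suc k) →
    ∃₂ λ a b → pow2TimesOdd a b ≡ suc m
  split m rec with halve (suc m)
  ... | h     , inj₂ eq = 0 , h , trans (pow2TimesOdd-zero h) (sym eq)
  ... | suc h , inj₁ eq with rec (subst (h <_) (sym (suc-injective eq)) (m<m+n h z<s))
  ...   | a , b , eq′ = suc a , b , trans (pow2TimesOdd-suc a b) (trans (cong₂ _+_ eq′ eq′) (sym eq))

suc-pair : ∀ a b → suc (pair a b) ≡ pow2TimesOdd a b
suc-pair a b = trans (+-comm 1 (pair a b)) (m∸n+n≡m (pow2TimesOdd>0 a b))

pair-injective : ∀ a b a′ b′ → pair a b ≡ pair a′ b′ → a ≡ a′ × b ≡ b′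
pair-injective a b a′ b′ eq =
  pow2TimesOdd-injective (trans (sym (suc-pair a b)) (trans (cong suc eq) (suc-pair a′ b′)))

pair-surjective : ∀ m → ∃₂ λ a b → pair a b ≡ m
pair-surjective m with pow2TimesOdd-surjective m
... | a , b , eq = a , b , suc-injective (trans (suc-pair a b) eq)

n<2^n : ∀ n → n < 2 ^ n
n<2^n zero    = z<s
n<2^n (suc n) = +-mono-≤-< (m^n>0 2 n) (≤-trans (n<2^n n) (m≤m+n (2 ^ n) 0))

pair-≥ˡ : ∀ a b → a ≤ pair a b
pair-≥ˡ a b = m<1+n⇒m≤n (begin-strict
  a                       <⟨ n<2^n a ⟩
  2 ^ a                   ≡⟨ sym (*-identityʳ (2 ^ a)) ⟩
  2 ^ a * 1               ≤⟨ *-monoʳ-≤ (2 ^ a) (m≤n+m 1 (2 * b)) ⟩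
  pow2TimesOdd a b        ≡⟨ sym (suc-pair a b) ⟩
  suc (pair a b)          ∎)
  where open ≤-Reasoning

pair-≥ʳ : ∀ a b → b ≤ pair a b
pair-≥ʳ a b = m<1+n⇒m≤n (begin-strict
  b                       <⟨ s≤s (m≤m+n b b) ⟩
  suc (b + b)             ≡⟨ sym (odd-unfold b) ⟩
  2 * b + 1               ≡⟨ sym (*-identityˡ (2 * b + 1)) ⟩
  1 * (2 * b + 1)         ≤⟨ *-monoˡ-≤ (2 * b + 1) (m^n>0 2 a) ⟩
  pow2TimesOdd a b        ≡⟨ sym (suc-pair a b) ⟩
  suc (pair a b)          ∎)
  where open ≤-Reasoning

-- G at the components of m, found by bounded search since both are at most m.
atUnpair : ℕ → (ℕ → ℕ → ℕ) → ℕ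
atUnpair m G = ∑< (m + 1) (λ a → ∑< (m + 1) (λ b → eqTest (pair a b) m * G a b))

atUnpair-pair : ∀ a b G → atUnpair (pair a b) G ≡ G a b
atUnpair-pair a b G = begin
  atUnpair (pair a b) G
    ≡⟨ ∑<-single (m + 1) (≤⇒<+1 (pair-≥ˡ a b)) (λ a′ _ a′≢a → ∑<-zero (m + 1) (λ b′ _ →
         cong (_* G a′ b′)
              (eqTest-≢ {pair a′ b′} {m} (a′≢a ∘ proj₁ ∘ pair-injective a′ b′ a b)))) ⟩
  ∑< (m + 1) (λ b′ → eqTest (pair a b′) m * G a b′)
    ≡⟨ ∑<-single (m + 1) (≤⇒<+1 (pair-≥ʳ a b)) (λ b′ _ b′≢b →
         cong (_* G a b′) (eqTest-≢ {pair a b′} {m} (b′≢b ∘ proj₂ ∘ pair-injective a b′ a b))) ⟩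
  eqTest m m * G a b
    ≡⟨ cong (_* G a b) (eqTest-refl m) ⟩
  G a b + 0
    ≡⟨ +-identityʳ (G a b) ⟩
  G a b ∎
  where
  open ≡-Reasoning
  m : ℕ
  m = pair a b
  ≤⇒<+1 : ∀ {x} → x ≤ m → x < m + 1
  ≤⇒<+1 {x} x≤m = subst (x <_) (+-comm 1 m) (s≤s x≤m)

-- The order of X: 0, then the points q ⊲ a coded by suc (pair q a), ordered by
-- q ascending and then a descending

point : ℕ → ℕ → ℕ
point q a = suc (pair q a)

leCode : ℕ → ℕ → ℕ
leCode x y =
  isZero x + isNonZero x * isNonZero y * (ltTest (first (x ∸ 1)) (first (y ∸ 1))
                                           + eqTest (first (x ∸ 1)) (first (y ∸ 1))
                                             * leTest (second (y ∸ 1)) (second (x ∸ 1)))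
  where
  first second : ℕ → ℕ
  first  e = atUnpair e (λ a b → a)
  second e = atUnpair e (λ a b → b)

infix 4 _⊑_

_⊑_ : ℕ → ℕ → Set
x ⊑ y = leCode x y ≡ 1

PointLE : ℕ → ℕ → ℕ → ℕ → Set
PointLE q a q′ a′ = q < q′ ⊎ (q ≡ q′ × a′ ≤ a)

leCode-point : ∀ q a q′ a′ → leCode (point q a) (point q′ a′) ≡ ltTest q q′ + eqTest q q′ * leTest a′ a
leCode-point q a q′ a′
  rewrite atUnpair-pair q a (λ a _ → a) | atUnpair-pair q′ a′ (λ a _ → a)
        | atUnpair-pair q a (λ _ b → b) | atUnpair-pair q′ a′ (λ _ b → b)
  = +-identityʳ _

point-⊑ : ∀ q a q′ a′ → point q a ⊑ point q′ a′ → PointLE q a q′ a′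
point-⊑ q a q′ a′ le with <-cmp q q′ | trans (sym (leCode-point q a q′ a′)) le
... | tri< q<q′ _ _ | _ = inj₁ q<q′
... | tri≈ _ refl _ | lex≡1 rewrite ltTest-≥ (≤-refl {q}) | eqTest-refl q | +-identityʳ (leTest a′ a) =
  inj₂ (refl , leTest≡1⇒≤ a′ a lex≡1)
... | tri> _ q≢q′ q′<q | lex≡1 rewrite ltTest-≥ (<⇒≤ q′<q) | eqTest-≢ q≢q′ = ⊥-elim (0≢1+n lex≡1)

⊑-point : ∀ q a q′ a′ → PointLE q a q′ a′ → point q a ⊑ point q′ a′
⊑-point q a q′ a′ le = trans (leCode-point q a q′ a′) (lex≡1 le)
  where
  lex≡1 : PointLE q a q′ a′ → ltTest q q′ + eqTest q q′ * leTest a′ a ≡ 1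
  lex≡1 (inj₁ q<q′) rewrite ltTest-< q<q′ | eqTest-≢ (<⇒≢ q<q′) = refl
  lex≡1 (inj₂ (refl , a′≤a)) rewrite ltTest-≥ (≤-refl {q}) | eqTest-refl q | leTest-≤ a′≤a = refl

pointView : ∀ x → x ≡ 0 ⊎ ∃₂ λ q a → x ≡ point q a
pointView zero    = inj₁ refl
pointView (suc x) with pair-surjective x
... | q , a , eq = inj₂ (q , a , cong suc (sym eq))

point-⋢-0 : ∀ q a → ¬ point q a ⊑ 0
point-⋢-0 q a ()

⊑-refl : ∀ x → x ⊑ x
⊑-refl x with pointView x
... | inj₁ refl              = refl
... | inj₂ (q , a , refl)    = ⊑-point q a q a (inj₂ (refl , ≤-refl))

⊑-antisym : ∀ x y → x ⊑ y → y ⊑ x → x ≡ y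
⊑-antisym x y x⊑y y⊑x with pointView x | pointView y
... | inj₁ refl           | inj₁ refl             = refl
... | inj₁ refl           | inj₂ (q , a , refl)   = ⊥-elim (point-⋢-0 q a y⊑x)
... | inj₂ (q , a , refl) | inj₁ refl             = ⊥-elim (point-⋢-0 q a x⊑y)
... | inj₂ (q , a , refl) | inj₂ (q′ , a′ , refl) with point-⊑ q a q′ a′ x⊑y | point-⊑ q′ a′ q a y⊑x
...   | inj₁ q<q′           | inj₁ q′<q           = ⊥-elim (<-asym q<q′ q′<q)
...   | inj₁ q<q′           | inj₂ (refl , _)     = ⊥-elim (<-irrefl refl q<q′)
...   | inj₂ (refl , _)     | inj₁ q′<q           = ⊥-elim (<-irrefl refl q′<q)
...   | inj₂ (refl , a′≤a)  | inj₂ (_ , a≤a′)     = cong (point q) (≤-antisym a≤a′ a′≤a)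

PointLE-trans : ∀ {q a q′ a′ q″ a″} → PointLE q a q′ a′ → PointLE q′ a′ q″ a″ → PointLE q a q″ a″
PointLE-trans (inj₁ q<q′)          (inj₁ q′<q″)          = inj₁ (<-trans q<q′ q′<q″)
PointLE-trans (inj₁ q<q′)          (inj₂ (refl , _))     = inj₁ q<q′
PointLE-trans (inj₂ (refl , _))    (inj₁ q′<q″)          = inj₁ q′<q″
PointLE-trans (inj₂ (refl , a′≤a)) (inj₂ (refl , a″≤a′)) = inj₂ (refl , ≤-trans a″≤a′ a′≤a)

⊑-trans : ∀ x y z → x ⊑ y → y ⊑ z → x ⊑ z
⊑-trans x y z x⊑y y⊑z with pointView x | pointView y | pointView z
... | inj₁ refl           | _                   | _                   = refl
... | inj₂ (q , a , refl) | inj₁ refl           | _                   = ⊥-elim (point-⋢-0 q a x⊑y)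
... | inj₂ _              | inj₂ (q , a , refl) | inj₁ refl           = ⊥-elim (point-⋢-0 q a y⊑z)
... | inj₂ (q , a , refl) | inj₂ (q′ , a′ , refl) | inj₂ (q″ , a″ , refl) =
  ⊑-point q a q″ a″ (PointLE-trans (point-⊑ q a q′ a′ x⊑y) (point-⊑ q′ a′ q″ a″ y⊑z))

⊑-total : ∀ x y → x ⊑ y ⊎ y ⊑ x
⊑-total x y with pointView x | pointView y
... | inj₁ refl           | _                     = inj₁ refl
... | inj₂ _              | inj₁ refl             = inj₂ refl
... | inj₂ (q , a , refl) | inj₂ (q′ , a′ , refl) with <-cmp q q′ | ≤-total a a′
...   | tri< q<q′ _ _ | _         = inj₁ (⊑-point q a q′ a′ (inj₁ q<q′))
...   | tri> _ _ q′<q | _         = inj₂ (⊑-point q′ a′ q a (inj₁ q′<q))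
...   | tri≈ _ refl _ | inj₁ a≤a′ = inj₂ (⊑-point q a′ q a (inj₂ (refl , a≤a′)))
...   | tri≈ _ refl _ | inj₂ a′≤a = inj₁ (⊑-point q a q a′ (inj₂ (refl , a′≤a)))

PointLT : ℕ → ℕ → ℕ → ℕ → Set
PointLT q a q′ a′ = q < q′ ⊎ (q ≡ q′ × a′ < a)

point-⊏ : ∀ q a q′ a′ → point q a ⊑ point q′ a′ → point q a ≢ point q′ a′ → PointLT q a q′ a′
point-⊏ q a q′ a′ le ne with point-⊑ q a q′ a′ le
... | inj₁ q<q′           = inj₁ q<q′
... | inj₂ (refl , a′≤a)  = inj₂ (refl , ≤∧≢⇒< a′≤a (λ { refl → ne refl }))

⊏-point : ∀ q {a a′} → a′ < a → point q a ⊑ point q a′ × point q a ≢ point q a′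
⊏-point q {a} {a′} a′<a =
    ⊑-point q a q a′ (inj₂ (refl , <⇒≤ a′<a))
  , λ eq → <⇒≢ a′<a (sym (proj₂ (pair-injective q a q a′ (suc-injective eq))))

measure : ℕ → ℕ → ℕ → ℕ
measure M q a = q * suc M + (M ∸ a)

measure-< : ∀ M {q a q′ a′} → PointLT q′ a′ q a → a′ ≤ M → measure M q′ a′ < measure M q a
measure-< M {q} {a} {q′} {a′} (inj₁ q′<q) _ = begin-strict
  q′ * suc M + (M ∸ a′)  ≤⟨ +-monoʳ-≤ (q′ * suc M) (m∸n≤m M a′) ⟩
  q′ * suc M + M         <⟨ +-monoʳ-< (q′ * suc M) ≤-refl ⟩
  q′ * suc M + suc M     ≡⟨ +-comm (q′ * suc M) (suc M) ⟩
  suc q′ * suc M         ≤⟨ *-monoˡ-≤ (suc M) q′<q ⟩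
  q * suc M              ≤⟨ m≤m+n (q * suc M) (M ∸ a) ⟩
  q * suc M + (M ∸ a)    ∎
  where open ≤-Reasoning
measure-< M {q} (inj₂ (refl , a<a′)) a′≤M = +-monoʳ-< (q * suc M) (∸-monoʳ-< a<a′ a′≤M)

descent-length : ∀ M (q a : ℕ → ℕ) → (∀ i → PointLT (q (suc i)) (a (suc i)) (q i) (a i)) →
  ∀ N → (∀ i → i ≤ N → a i ≤ M) → measure M (q N) (a N) + N ≤ measure M (q 0) (a 0)
descent-length M q a descending zero    a≤M = ≤-reflexive (+-identityʳ _)
descent-length M q a descending (suc N) a≤M = begin
  measure M (q (suc N)) (a (suc N)) + suc N
    ≡⟨ +-suc _ N ⟩
  suc (measure M (q (suc N)) (a (suc N))) + N
    ≤⟨ +-monoˡ-≤ N (measure-< M (descending N) (a≤M (suc N) ≤-refl)) ⟩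
  measure M (q N) (a N) + N
    ≤⟨ descent-length M q a descending N (λ i i≤N → a≤M i (m≤n⇒m≤1+n i≤N)) ⟩
  measure M (q 0) (a 0) ∎
  where open ≤-Reasoning

applyUpTo-BDecr : ∀ N (P : ℕ → Entry) → (∀ i → suc i < N → proj₁ (P (suc i)) < proj₁ (P i)) →
  BDecr (applyUpTo P N)
applyUpTo-BDecr zero          P decr = tt
applyUpTo-BDecr (suc zero)    P decr = tt
applyUpTo-BDecr (suc (suc N)) P decr =
  decr 0 (s≤s (s≤s z≤n)) , applyUpTo-BDecr (suc N) (P ∘ suc) (λ i i<N → decr (suc i) (s≤s i<N))

applyUpTo-LexLt : ∀ (lt : ℕ → ℕ → Set) N r (P Q : ℕ → Entry) → r < N →
  (∀ i → i < r → P i ≡ Q i) → proj₁ (P r) ≡ proj₁ (Q r) → lt (proj₂ (P r)) (proj₂ (Q r)) →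
  LexLt lt (applyUpTo P N) (applyUpTo Q N)
applyUpTo-LexLt lt (suc N) zero    P Q _         _     b≡b′ a<a′ = inj₂ (b≡b′ , inj₁ a<a′)
applyUpTo-LexLt lt (suc N) (suc r) P Q (s≤s r<N) P≗Q b≡b′ a<a′ =
  inj₂ (cong proj₁ (P≗Q 0 z<s) , inj₂ (cong proj₂ (P≗Q 0 z<s) ,
    applyUpTo-LexLt lt N r (P ∘ suc) (Q ∘ suc) r<N (λ i i<r → P≗Q (suc i) (s≤s i<r)) b≡b′ a<a′))

-- The forward functional
--
-- Slot suc d (d < n) is the placeholder of colour d, slot x + suc n records time x; all
-- live slots lie below bound t, and position t k is the k-th of them (position t 0 = 0).

module Reduction (g : Oracle) where

  colours : ℕ
  colours = g 0

  colour : ℕ → ℕ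
  colour y = g (suc y)

  occurrences : ℕ → ℕ → ℕ → ℕ
  occurrences c lo hi = ∑< hi (λ y → leTest lo y * eqTest (colour y) c)

  live : ℕ → ℕ → ℕ
  live t v =
    isNonZero v * leTest v colours * isZero (occurrences (v ∸ 1) 0 t)
    + leTest (suc colours) v * ltTest (v ∸ suc colours) t
      * isZero (occurrences (colour (v ∸ suc colours)) (suc (v ∸ suc colours)) t)

  liveBelow : ℕ → ℕ → ℕ
  liveBelow t v = ∑< v (live t)

  bound : ℕ → ℕ
  bound t = t + suc colours

  position : ℕ → ℕ → ℕ
  position t k = ∑< (bound t) (λ v → ltTest (liveBelow t (suc v)) k)

  entry : ℕ → ℕ → ℕ
  entry t i = point (position t i) (position t (suc i))

  byKind : ℕ → ℕ → ℕ
  byKind k r =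
    eqTest k 0 + eqTest k 1 * atUnpair r leCode + eqTest k 2 * colours
    + eqTest k 3 * atUnpair r (λ t i → colours ∸ suc i) + eqTest k 4 * atUnpair r entry

  instanceName : Oracle
  instanceName m = atUnpair m byKind

-- The same functions as oracle expressions, variable 0 being the innermost.  The
-- denotation ⟦ instanceNameᴱ ⟧ g (m ∷ []) unfolds definitionally to instanceName g m,
-- which is what mainTheorem17 relies on.

instanceNameᴱ : Expr 1
instanceNameᴱ = atUnpairᴱ byKindᴱ
  where
  x₀ : ∀ {k} → Expr (suc k)
  x₀ = var zero
  x₁ : ∀ {k} → Expr (suc (suc k))
  x₁ = var (suc zero)
  x₂ : ∀ {k} → Expr (suc (suc (suc k)))
  x₂ = var (suc (suc zero))

  eqTestᴱ ltTestᴱ leTestᴱ pairᴱ : ∀ {k} → Expr k → Expr k → Expr k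
  eqTestᴱ a b = isZeroᴱ ((a ∸ᴱ b) +ᴱ (b ∸ᴱ a))
  ltTestᴱ a b = isNonZeroᴱ (b ∸ᴱ a)
  leTestᴱ a b = isZeroᴱ (a ∸ᴱ b)
  pairᴱ a b   = 2^ᴱ a *ᴱ (lit 2 *ᴱ b +ᴱ lit 1) ∸ᴱ lit 1

  coloursᴱ : ∀ {k} → Expr k
  coloursᴱ = oracle (lit 0)
  colourᴱ : ∀ {k} → Expr k → Expr k
  colourᴱ y = oracle (lit 1 +ᴱ y)

  atUnpairᴱ : Expr 2 → Expr 1
  atUnpairᴱ G =
    ∑<ᴱ (x₀ +ᴱ lit 1) (∑<ᴱ (x₁ +ᴱ lit 1) (eqTestᴱ (pairᴱ x₁ x₀) x₂ *ᴱ (G ∘ᴱ (x₁ ∷ x₀ ∷ []))))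

  occurrencesᴱ : Expr 3
  occurrencesᴱ = ∑<ᴱ x₂ (leTestᴱ x₂ x₀ *ᴱ eqTestᴱ (colourᴱ x₀) x₁)

  liveᴱ : Expr 2
  liveᴱ = isNonZeroᴱ x₁ *ᴱ leTestᴱ x₁ coloursᴱ
          *ᴱ isZeroᴱ (occurrencesᴱ ∘ᴱ (x₁ ∸ᴱ lit 1 ∷ lit 0 ∷ x₀ ∷ []))
        +ᴱ leTestᴱ (lit 1 +ᴱ coloursᴱ) x₁ *ᴱ ltTestᴱ time x₀
           *ᴱ isZeroᴱ (occurrencesᴱ ∘ᴱ (colourᴱ time ∷ lit 1 +ᴱ time ∷ x₀ ∷ []))
    where
    time : Expr 2
    time = x₁ ∸ᴱ (lit 1 +ᴱ coloursᴱ)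

  liveBelowᴱ : Expr 2
  liveBelowᴱ = ∑<ᴱ x₁ (liveᴱ ∘ᴱ (x₁ ∷ x₀ ∷ []))

  positionᴱ : Expr 2
  positionᴱ =
    ∑<ᴱ (x₀ +ᴱ (lit 1 +ᴱ coloursᴱ)) (ltTestᴱ (liveBelowᴱ ∘ᴱ (x₁ ∷ lit 1 +ᴱ x₀ ∷ [])) x₂)

  entryᴱ : Expr 2
  entryᴱ = lit 1 +ᴱ pairᴱ (positionᴱ ∘ᴱ (x₀ ∷ x₁ ∷ [])) (positionᴱ ∘ᴱ (x₀ ∷ lit 1 +ᴱ x₁ ∷ []))

  leCodeᴱ : Expr 2
  leCodeᴱ =
    isZeroᴱ x₀ +ᴱ isNonZeroᴱ x₀ *ᴱ isNonZeroᴱ x₁ *ᴱ (ltTestᴱ qx qy +ᴱ eqTestᴱ qx qy *ᴱ leTestᴱ ay ax)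
    where
    qx qy ax ay : Expr 2
    qx = atUnpairᴱ x₀ ∘ᴱ (x₀ ∸ᴱ lit 1 ∷ [])
    qy = atUnpairᴱ x₀ ∘ᴱ (x₁ ∸ᴱ lit 1 ∷ [])
    ax = atUnpairᴱ x₁ ∘ᴱ (x₀ ∸ᴱ lit 1 ∷ [])
    ay = atUnpairᴱ x₁ ∘ᴱ (x₁ ∸ᴱ lit 1 ∷ [])

  byKindᴱ : Expr 2
  byKindᴱ = eqTestᴱ x₀ (lit 0) +ᴱ eqTestᴱ x₀ (lit 1) *ᴱ (atUnpairᴱ leCodeᴱ ∘ᴱ (x₁ ∷ []))
          +ᴱ eqTestᴱ x₀ (lit 2) *ᴱ coloursᴱ
          +ᴱ eqTestᴱ x₀ (lit 3) *ᴱ (atUnpairᴱ (coloursᴱ ∸ᴱ (lit 1 +ᴱ x₁)) ∘ᴱ (x₁ ∷ []))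
          +ᴱ eqTestᴱ x₀ (lit 4) *ᴱ (atUnpairᴱ entryᴱ ∘ᴱ (x₁ ∷ []))

module Stages (g : Oracle) (colour<colours : ∀ x → g (suc x) < g 0) where

  open Reduction g

  occurrences≢0 : ∀ {c lo hi y} → lo ≤ y → y < hi → colour y ≡ c → occurrences c lo hi ≢ 0
  occurrences≢0 {c} {lo} {hi} {y} lo≤y y<hi refl =
    n>0⇒n≢0 (subst (_≤ occurrences c lo hi) term≡1 (term≤∑< hi y<hi))
    where
    term≡1 : leTest lo y * eqTest c c ≡ 1
    term≡1 rewrite leTest-≤ lo≤y | eqTest-refl c = refl

  occurrences-witness : ∀ c lo hi → occurrences c lo hi ≢ 0 →
    ∃ λ y → lo ≤ y × y < hi × colour y ≡ c
  occurrences-witness c lo hi occ≢0 with ∑<-witness hi occ≢0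
  ... | y , y<hi , term≢0 with lo ≤? y | colour y ≟ c
  ...   | yes lo≤y | yes eq  = y , lo≤y , y<hi , eq
  ...   | no lo≰y  | _       = ⊥-elim (term≢0 (cong (_* eqTest (colour y) c) (leTest-> (≰⇒> lo≰y))))
  ...   | yes _    | no c≢c′ =
    ⊥-elim (term≢0 (trans (cong (leTest lo y *_) (eqTest-≢ c≢c′)) (*-zeroʳ (leTest lo y))))

  occurrences-none : ∀ c lo hi → (∀ y → lo ≤ y → y < hi → colour y ≢ c) → occurrences c lo hi ≡ 0
  occurrences-none c lo hi none with occurrences c lo hi ≟ 0
  ... | yes occ≡0 = occ≡0
  ... | no occ≢0 with occurrences-witness c lo hi occ≢0
  ...   | y , lo≤y , y<hi , eq = ⊥-elim (none y lo≤y y<hi eq)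

  occurrences-suc-≢ : ∀ {c lo t} → colour t ≢ c → occurrences c lo (suc t) ≡ occurrences c lo t
  occurrences-suc-≢ {c} {lo} {t} colour≢c =
    trans (cong (occurrences c lo t +_)
                (trans (cong (leTest lo t *_) (eqTest-≢ colour≢c)) (*-zeroʳ (leTest lo t))))
          (+-identityʳ _)

  isZero-occurrences-suc-seen : ∀ {c lo t y} → lo ≤ y → y < t → colour y ≡ c →
    isZero (occurrences c lo (suc t)) ≡ isZero (occurrences c lo t)
  isZero-occurrences-suc-seen lo≤y y<t eq =
    trans (isZero-≢0 (occurrences≢0 lo≤y (m<n⇒m<1+n y<t) eq))
          (sym (isZero-≢0 (occurrences≢0 lo≤y y<t eq)))

  live-colourSlot : ∀ t {d} → d < colours → live t (suc d) ≡ isZero (occurrences d 0 t)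
  live-colourSlot t d<n rewrite leTest-≤ d<n | leTest-> (s≤s d<n) = trans (+-identityʳ _) (+-identityʳ _)

  live-timeSlot : ∀ t x →
    live t (x + suc colours) ≡ ltTest x t * isZero (occurrences (colour x) (suc x) t)
  live-timeSlot t x
    rewrite m+n∸n≡m x (suc colours) | leTest-≤ (m≤n+m (suc colours) x)
          | leTest-> (≤-trans (s≤s (m≤n+m colours x)) (≤-reflexive (sym (+-suc x colours))))
          | *-zeroʳ (isNonZero (x + suc colours))
    = cong (_* isZero (occurrences (colour x) (suc x) t)) (+-identityʳ (ltTest x t))

  data Slot : ℕ → Set where
    origin     : Slot 0
    colourSlot : ∀ d → d < colours → Slot (suc d)
    timeSlot   : ∀ x → Slot (x + suc colours)

  slot : ∀ v → Slot v
  slot zero = origin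
  slot (suc d) with d <? colours
  ... | yes d<n = colourSlot d d<n
  ... | no d≮n  = subst Slot (trans (+-suc (d ∸ colours) colours) (cong suc (m∸n+n≡m (≮⇒≥ d≮n))))
                             (timeSlot (d ∸ colours))

  data LastOccurrence (c t : ℕ) : Set where
    none : (∀ y → y < t → colour y ≢ c) → LastOccurrence c t
    last : ∀ x → x < t → colour x ≡ c → (∀ y → x < y → y < t → colour y ≢ c) → LastOccurrence c t

  lastOccurrence : ∀ c t → LastOccurrence c t
  lastOccurrence c zero = none (λ _ ())
  lastOccurrence c (suc t) with colour t ≟ c
  ... | yes eq = last t ≤-refl eq (λ y t<y y<1+t → ⊥-elim (<⇒≱ t<y (m<1+n⇒m≤n y<1+t)))
  ... | no colour≢c with lastOccurrence c t
  ...   | none before = none (λ y y<1+t →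
    [ before y , (λ { refl → colour≢c }) ]′ (m<1+n⇒m<n∨m≡n y<1+t))
  ...   | last x x<t eq after = last x (m<n⇒m<1+n x<t) eq (λ y x<y y<1+t →
    [ after y x<y , (λ { refl → colour≢c }) ]′ (m<1+n⇒m<n∨m≡n y<1+t))

  slotOf : ∀ {c t} → LastOccurrence c t → ℕ
  slotOf {c} (none _)       = suc c
  slotOf     (last x _ _ _) = x + suc colours

  newest-live : ∀ t → live (suc t) (bound t) ≡ 1
  newest-live t
    rewrite live-timeSlot (suc t) t | ltTest-< (≤-refl {suc t})
          | occurrences-none (colour t) (suc t) (suc t) (λ y t<y y≤t → ⊥-elim (<⇒≱ t<y (m<1+n⇒m≤n y≤t)))
    = refl

  liveBelow-initial : ∀ m → m ≤ colours → liveBelow 0 (suc m) ≡ m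
  liveBelow-initial zero    _   = refl
  liveBelow-initial (suc m) m<n =
    trans (cong₂ _+_ (liveBelow-initial m (<⇒≤ m<n)) (live-colourSlot 0 m<n)) (+-comm m 1)

  liveBelow-mono : ∀ t {v v′} → v ≤ v′ → liveBelow t v ≤ liveBelow t v′
  liveBelow-mono t = ∑<-mono (live t)

  liveBelow-suc-live : ∀ t v → live t v ≡ 1 → liveBelow t (suc v) ≡ suc (liveBelow t v)
  liveBelow-suc-live t v live≡1 = trans (cong (liveBelow t v +_) live≡1) (+-comm _ 1)

  -- From stage t to suc t exactly one slot, the one holding colour t, stops being live.
  module Step (t : ℕ) where

    retired : ℕ
    retired = slotOf (lastOccurrence (colour t) t)

    retired-live : live t retired ≡ 1
    retired-live with lastOccurrence (colour t) t
    ... | none before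
      rewrite live-colourSlot t (colour<colours t) | occurrences-none (colour t) 0 t (λ y _ → before y)
      = refl
    ... | last x x<t eq after
      rewrite live-timeSlot t x | ltTest-< x<t | eq | occurrences-none (colour t) (suc x) t after = refl

    retired<bound : retired < bound t
    retired<bound with lastOccurrence (colour t) t
    ... | none _         = ≤-trans (s≤s (colour<colours t)) (m≤n+m (suc colours) t)
    ... | last x x<t _ _ = +-monoˡ-< (suc colours) x<t

    retired-dead : live (suc t) retired ≡ 0
    retired-dead with lastOccurrence (colour t) t
    ... | none _ rewrite live-colourSlot (suc t) (colour<colours t) =
      isZero-≢0 (occurrences≢0 {y = t} z≤n ≤-refl refl)
    ... | last x x<t eq _ rewrite live-timeSlot (suc t) x =
      trans (cong (ltTest x (suc t) *_) (isZero-≢0 (occurrences≢0 {y = t} x<t ≤-refl (sym eq))))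
            (*-zeroʳ (ltTest x (suc t)))

    colourSlot-stable : ∀ d → suc d ≢ retired →
      isZero (occurrences d 0 (suc t)) ≡ isZero (occurrences d 0 t)
    colourSlot-stable d ne with colour t ≟ d
    ... | no colour≢d = cong isZero (occurrences-suc-≢ colour≢d)
    ... | yes refl with lastOccurrence (colour t) t
    ...   | none _          = ⊥-elim (ne refl)
    ...   | last x x<t eq _ = isZero-occurrences-suc-seen z≤n x<t eq

    timeSlot-stable : ∀ x → x < t → x + suc colours ≢ retired →
      isZero (occurrences (colour x) (suc x) (suc t)) ≡ isZero (occurrences (colour x) (suc x) t)
    timeSlot-stable x x<t ne with colour t ≟ colour x
    ... | no colour≢ = cong isZero (occurrences-suc-≢ colour≢)
    ... | yes eq with lastOccurrence (colour t) t
    ...   | none before = ⊥-elim (before x x<t (sym eq))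
    ...   | last x′ x′<t eq′ after with <-cmp x x′
    ...     | tri≈ _ refl _ = ⊥-elim (ne refl)
    ...     | tri> _ _ x′<x = ⊥-elim (after x x′<x x<t (sym eq))
    ...     | tri< x<x′ _ _ = isZero-occurrences-suc-seen x<x′ x′<t (trans eq′ eq)

    live-stable : ∀ v → v < bound t → v ≢ retired → live (suc t) v ≡ live t v
    live-stable v v<bound v≢retired with slot v
    ... | origin = refl
    ... | colourSlot d d<n rewrite live-colourSlot (suc t) d<n | live-colourSlot t d<n =
      colourSlot-stable d v≢retired
    ... | timeSlot x rewrite live-timeSlot (suc t) x | live-timeSlot t x =
      cong₂ _*_ (trans (ltTest-< (m<n⇒m<1+n x<t)) (sym (ltTest-< x<t))) (timeSlot-stable x x<t v≢retired)
      where
      x<t : x < t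
      x<t = +-cancelʳ-< (suc colours) x t v<bound

  liveBelow-bound : ∀ t → liveBelow t (bound t) ≡ colours
  liveBelow-bound zero    = liveBelow-initial colours ≤-refl
  liveBelow-bound (suc t) = begin
    liveBelow (suc t) (bound t) + live (suc t) (bound t)
      ≡⟨ cong (liveBelow (suc t) (bound t) +_) (newest-live t) ⟩
    liveBelow (suc t) (bound t) + 1
      ≡⟨ +-comm _ 1 ⟩
    suc (liveBelow (suc t) (bound t))
      ≡⟨ sym (∑<-remove (bound t) retired<bound retired-live retired-dead live-stable) ⟩
    liveBelow t (bound t)
      ≡⟨ liveBelow-bound t ⟩
    colours ∎
    where
    open Step t
    open ≡-Reasoning

  position≤bound : ∀ t k → position t k ≤ bound t
  position≤bound t k =
    ∑<-≤ (bound t) (λ v → ltTest≤1 (liveBelow t (suc v)) k) (λ v b≤v v<b → ⊥-elim (<⇒≱ v<b b≤v))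

  ≤-liveBelow-position : ∀ t k → k ≤ colours → k ≤ liveBelow t (suc (position t k))
  ≤-liveBelow-position t k k≤n with k ≤? liveBelow t (suc (position t k))
  ... | yes k≤ = k≤
  ... | no k≰ with suc (position t k) ≤? bound t
  ...   | yes p<b = ⊥-elim (<-irrefl refl (∑<-≥ _ p<b (λ v v≤p →
    ltTest-< {liveBelow t (suc v)} (≤-<-trans (liveBelow-mono t v≤p) (≰⇒> k≰)))))
  ...   | no p≮b  = ⊥-elim (k≰ (≤-trans k≤n
    (≤-trans (≤-reflexive (sym (liveBelow-bound t))) (liveBelow-mono t (<⇒≤ (≰⇒> p≮b))))))

  position-suc≤ : ∀ t k {v} → live t v ≡ 1 → position t k < v → k < colours → position t (suc k) ≤ v
  position-suc≤ t k {v} live≡1 pos<v k<n =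
    ∑<-≤ (bound t) (λ v′ → ltTest≤1 (liveBelow t (suc v′)) (suc k)) beyond
    where
    beyond : ∀ v′ → v ≤ v′ → v′ < bound t → ltTest (liveBelow t (suc v′)) (suc k) ≡ 0
    beyond v′ v≤v′ _ = ltTest-≥ {liveBelow t (suc v′)} (begin
      suc k                 ≤⟨ s≤s (≤-trans (≤-liveBelow-position t k (<⇒≤ k<n)) (liveBelow-mono t pos<v)) ⟩
      suc (liveBelow t v)   ≡⟨ sym (liveBelow-suc-live t v live≡1) ⟩
      liveBelow t (suc v)   ≤⟨ liveBelow-mono t (s≤s v≤v′) ⟩
      liveBelow t (suc v′)  ∎)
      where open ≤-Reasoning

  module Rank (t : ℕ) where

    open Step t

    rank : ℕ
    rank = liveBelow t retired

    suc-rank : liveBelow t (suc retired) ≡ suc rank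
    suc-rank = liveBelow-suc-live t retired retired-live

    rank<colours : rank < colours
    rank<colours = ≤-trans (≤-reflexive (sym suc-rank))
                           (≤-trans (liveBelow-mono t retired<bound) (≤-reflexive (liveBelow-bound t)))

    position-rank : position t (suc rank) ≡ retired
    position-rank = ≤-antisym
      (∑<-≤ (bound t) (λ v → ltTest≤1 (liveBelow t (suc v)) (suc rank))
        (λ v retired≤v _ → ltTest-≥ {liveBelow t (suc v)}
          (≤-trans (≤-reflexive (sym suc-rank)) (liveBelow-mono t (s≤s retired≤v)))))
      (∑<-≥ _ (<⇒≤ retired<bound) (λ v v<retired →
          ltTest-< {liveBelow t (suc v)} (s≤s (liveBelow-mono t v<retired))))

    liveBelow-suc-below : ∀ {v} → v ≤ retired → liveBelow (suc t) v ≡ liveBelow t v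
    liveBelow-suc-below v≤retired = ∑<-cong _ (λ w w<v →
      live-stable w (<-trans (<-≤-trans w<v v≤retired) retired<bound) (<⇒≢ (<-≤-trans w<v v≤retired)))

    liveBelow-suc-retired : liveBelow (suc t) (suc retired) ≡ rank
    liveBelow-suc-retired = trans (cong₂ _+_ (liveBelow-suc-below ≤-refl) retired-dead) (+-identityʳ rank)

    rank≤liveBelow-suc : ∀ {v} → retired ≤ v → rank ≤ liveBelow (suc t) (suc v)
    rank≤liveBelow-suc retired≤v =
      ≤-trans (≤-reflexive (sym liveBelow-suc-retired)) (liveBelow-mono (suc t) (s≤s retired≤v))

    position-suc-stable : ∀ {i} → i ≤ rank → position (suc t) i ≡ position t i
    position-suc-stable {i} i≤rank =
      trans (cong₂ _+_ (∑<-cong (bound t) same)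
                       (ltTest-≥ (≤-trans i≤rank (rank≤liveBelow-suc (<⇒≤ retired<bound)))))
            (+-identityʳ _)
      where
      same : ∀ v → v < bound t → ltTest (liveBelow (suc t) (suc v)) i ≡ ltTest (liveBelow t (suc v)) i
      same v _ with v <? retired
      ... | yes v<retired = cong (λ l → ltTest l i) (liveBelow-suc-below v<retired)
      ... | no v≮retired  = trans (ltTest-≥ (≤-trans i≤rank (rank≤liveBelow-suc (≮⇒≥ v≮retired))))
        (sym (ltTest-≥ (≤-trans (≤-trans i≤rank (n≤1+n rank))
                                (≤-trans (≤-reflexive (sym suc-rank)) (liveBelow-mono t (s≤s (≮⇒≥ v≮retired)))))))

    retired<position-suc : retired < position (suc t) (suc rank)
    retired<position-suc = ∑<-≥ _ (≤-trans retired<bound (n≤1+n _))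
      (λ v v≤retired →
        ltTest-< (s≤s (≤-trans (liveBelow-mono (suc t) v≤retired) (≤-reflexive liveBelow-suc-retired))))

module Forward (g : Oracle) (colour<colours : ∀ x → g (suc x) < g 0) where

  open Reduction g
  open Stages g colour<colours

  instanceName-member : ∀ x → memX instanceName x
  instanceName-member x = atUnpair-pair 0 x byKind

  instanceName-order : ∀ x y → instanceName (pair 1 (pair x y)) ≡ leCode x y
  instanceName-order x y =
    trans (atUnpair-pair 1 (pair x y) byKind)
      (trans (+-identityʳ _) (trans (+-identityʳ _) (trans (+-identityʳ _) (trans (+-identityʳ _)
        (atUnpair-pair x y leCode)))))

  instanceName-length : ∀ t → lenσ instanceName t ≡ colours
  instanceName-length t =
    trans (atUnpair-pair 2 t byKind) (trans (+-identityʳ _) (trans (+-identityʳ _) (+-identityʳ _)))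

  instanceName-b : ∀ t i → bσ instanceName t i ≡ colours ∸ suc i
  instanceName-b t i =
    trans (atUnpair-pair 3 (pair t i) byKind)
      (trans (+-identityʳ _) (trans (+-identityʳ _) (atUnpair-pair t i _)))

  instanceName-a : ∀ t i → aσ instanceName t i ≡ entry t i
  instanceName-a t i = trans (atUnpair-pair 4 (pair t i) byKind) (trans (+-identityʳ _) (atUnpair-pair t i _))

  leX⇒⊑ : ∀ x y → leX instanceName x y → x ⊑ y
  leX⇒⊑ x y = trans (sym (instanceName-order x y))

  ⊑⇒leX : ∀ x y → x ⊑ y → leX instanceName x y
  ⊑⇒leX x y = trans (instanceName-order x y)

  linearOrder : IsLinOrd0 instanceName
  linearOrder = record
    { field⊆    = λ x y _ → instanceName-member x , instanceName-member y
    ; refl      = λ x _ → ⊑⇒leX x x (⊑-refl x)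
    ; antisym   = λ x y x≤y y≤x → ⊑-antisym x y (leX⇒⊑ x y x≤y) (leX⇒⊑ y x y≤x)
    ; trans     = λ x y z x≤y y≤z → ⊑⇒leX x z (⊑-trans x y z (leX⇒⊑ x y x≤y) (leX⇒⊑ y z y≤z))
    ; total     = λ x y _ _ → Data.Sum.map (⊑⇒leX x y) (⊑⇒leX y x) (⊑-total x y)
    ; zero∈     = instanceName-member 0
    ; zeroLeast = λ x _ → ⊑⇒leX 0 x refl
    }

  term : ℕ → ℕ → Entry
  term t i = bσ instanceName t i , aσ instanceName t i

  σ-applyUpTo : ∀ t → σ instanceName t ≡ applyUpTo (term t) colours
  σ-applyUpTo t = trans (map-applyUpTo id (term t) (lenσ instanceName t))
                        (cong (applyUpTo (term t)) (instanceName-length t))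

  σ-InXω : ∀ t → InXω (memX instanceName) (σ instanceName t)
  σ-InXω t rewrite σ-applyUpTo t =
      applyUpTo-BDecr colours (term t) (λ i i<n →
        subst₂ _<_ (sym (instanceName-b t (suc i))) (sym (instanceName-b t i)) (∸-monoʳ-< ≤-refl i<n))
    , applyUpTo⁺₁ (term t) colours (λ {i} _ →
        instanceName-member (aσ instanceName t i) , λ a≡0 → 0≢1+n (trans (sym a≡0) (instanceName-a t i)))

  last-entry-decreases : ∀ t → ltX instanceName (entry (suc t) (Rank.rank t)) (entry t (Rank.rank t))
  last-entry-decreases t = subst₂ (ltX instanceName)
    (cong (λ q → point q (position (suc t) (suc rank))) (sym (position-suc-stable ≤-refl)))
    (cong (point (position t rank)) (sym position-rank))
    (Data.Product.map (⊑⇒leX (point q (position (suc t) (suc rank))) (point q retired)) id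
                      (⊏-point q retired<position-suc))
    where
    open Step t
    open Rank t
    q : ℕ
    q = position t rank

  σ-decreasing : ∀ t → LexLt (ltX instanceName) (σ instanceName (suc t)) (σ instanceName t)
  σ-decreasing t rewrite σ-applyUpTo (suc t) | σ-applyUpTo t =
    applyUpTo-LexLt (ltX instanceName) colours rank (term (suc t)) (term t) rank<colours
      (λ i i<rank → cong₂ _,_ (b-same i) (a-same i i<rank))
      (b-same rank)
      (subst₂ (ltX instanceName) (sym (instanceName-a (suc t) rank)) (sym (instanceName-a t rank))
              (last-entry-decreases t))
    where
    open Step t
    open Rank t
    b-same : ∀ i → bσ instanceName (suc t) i ≡ bσ instanceName t i
    b-same i = trans (instanceName-b (suc t) i) (sym (instanceName-b t i))
    a-same : ∀ i → i < rank → aσ instanceName (suc t) i ≡ aσ instanceName t i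
    a-same i i<rank = trans (instanceName-a (suc t) i)
      (trans (cong₂ point (position-suc-stable (<⇒≤ i<rank)) (position-suc-stable i<rank))
             (sym (instanceName-a t i)))

  instance-WOPω : Inst WOPω instanceName
  instance-WOPω = linearOrder , σ-InXω , σ-decreasing

module Backward (g : Oracle) (colour<colours : ∀ x → g (suc x) < g 0) (s : Oracle)
                (sol : Sol WOPω (Reduction.instanceName g) s) where

  open Reduction g
  open Stages g colour<colours
  open Forward g colour<colours

  stage : ℕ → ℕ
  stage = proj₁ (proj₂ (proj₂ sol))

  stage-mono : ∀ {i j} → i ≤ j → stage i ≤ stage j
  stage-mono {i} {j} i≤j with m≤n⇒m<n∨m≡n i≤j
  ... | inj₁ i<j  = proj₁ (proj₂ (proj₂ (proj₂ sol))) i j i<j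
  ... | inj₂ refl = ≤-refl

  contained : ∀ i → ∃ λ k → k < lenσ instanceName (stage i) × aσ instanceName (stage i) k ≡ s i
  contained = proj₂ (proj₂ (proj₂ (proj₂ sol)))

  index : ℕ → ℕ
  index i = proj₁ (contained i)

  index<colours : ∀ i → index i < colours
  index<colours i = subst (index i <_) (instanceName-length (stage i)) (proj₁ (proj₂ (contained i)))

  q a : ℕ → ℕ
  q i = position (stage i) (index i)
  a i = position (stage i) (suc (index i))

  s≡point : ∀ i → s i ≡ point (q i) (a i)
  s≡point i = trans (sym (proj₂ (proj₂ (contained i)))) (instanceName-a (stage i) (index i))

  descending : ∀ i → PointLT (q (suc i)) (a (suc i)) (q i) (a i)
  descending i = point-⊏ (q (suc i)) (a (suc i)) (q i) (a i)
    (subst₂ _⊑_ (s≡point (suc i)) (s≡point i) (leX⇒⊑ (s (suc i)) (s i) (proj₁ s⁺<s)))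
    (λ eq → proj₂ s⁺<s (trans (s≡point (suc i)) (trans eq (sym (s≡point i)))))
    where
    s⁺<s : ltX instanceName (s (suc i)) (s i)
    s⁺<s = proj₁ (proj₂ sol) i

  q≤q₀ : ∀ i → q i ≤ q 0
  q≤q₀ zero    = ≤-refl
  q≤q₀ (suc i) = ≤-trans (first≤ (descending i)) (q≤q₀ i)
    where
    first≤ : ∀ {x a x′ a′} → PointLT x a x′ a′ → x ≤ x′
    first≤ (inj₁ x<x′)       = <⇒≤ x<x′
    first≤ (inj₂ (refl , _)) = ≤-refl

  second≤slot : ∀ x i → q i < x + suc colours → occurrences (colour x) (suc x) (stage i) ≡ 0 →
    a i ≤ x + suc colours
  second≤slot x i q<slot unseen with stage i ≤? x
  ... | yes stage≤x =
    ≤-trans (position≤bound (stage i) (suc (index i))) (+-monoˡ-≤ (suc colours) stage≤x)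
  ... | no stage≰x  = position-suc≤ (stage i) (index i) slot-live q<slot (index<colours i)
    where
    slot-live : live (stage i) (x + suc colours) ≡ 1
    slot-live rewrite live-timeSlot (stage i) x | ltTest-< (≰⇒> stage≰x) | unseen = refl

  chainBound : ℕ → ℕ
  chainBound x = suc (measure (x + suc colours) (q 0) (a 0))

  never-recurring-absurd : ∀ x → s 0 < x →
    occurrences (colour x) (suc x) (stage (chainBound x)) ≡ 0 → ⊥
  never-recurring-absurd x s₀<x unseen =
    <-irrefl refl (≤-trans (m≤n+m N _) (descent-length M q a descending N a≤M))
    where
    M N : ℕ
    M = x + suc colours
    N = chainBound x

    q<M : ∀ i → q i < M
    q<M i = begin-strict
      q i                ≤⟨ q≤q₀ i ⟩
      q 0                ≤⟨ pair-≥ˡ (q 0) (a 0) ⟩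
      pair (q 0) (a 0)   <⟨ ≤-refl ⟩
      point (q 0) (a 0)  ≡⟨ sym (s≡point 0) ⟩
      s 0                <⟨ s₀<x ⟩
      x                  ≤⟨ m≤m+n x (suc colours) ⟩
      M                  ∎
      where open ≤-Reasoning

    a≤M : ∀ i → i ≤ N → a i ≤ M
    a≤M i i≤N = second≤slot x i (q<M i) (occurrences-none (colour x) (suc x) (stage i)
      (λ y x<y y<stage eq → occurrences≢0 x<y (<-≤-trans y<stage (stage-mono i≤N)) eq unseen))

  recurs : ∀ x → s 0 < x → ∃ λ y → x < y × colour y ≡ colour x
  recurs x s₀<x with occurrences (colour x) (suc x) (stage (chainBound x)) ≟ 0
  ... | yes unseen = ⊥-elim (never-recurring-absurd x s₀<x unseen)
  ... | no seen with occurrences-witness (colour x) (suc x) (stage (chainBound x)) seen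
  ...   | y , x<y , _ , eq = y , x<y , eq

-- It reads (X ⊕ Ŷ) 1 = Ŷ 0, the first term of the solution.
solutionHeadᴱ : Expr 1
solutionHeadᴱ = oracle (lit 1)

mainTheorem17 : ECT ≤W WOPω
mainTheorem17 = compile instanceNameᴱ , compile solutionHeadᴱ , λ X colour<colours →
    (λ m → ⟦ instanceNameᴱ ⟧ X (m ∷ [])) , compile-computes instanceNameᴱ X
  , Forward.instance-WOPω X colour<colours
  , λ Ŷ sol → (λ m → ⟦ solutionHeadᴱ ⟧ (X ⊕ Ŷ) (m ∷ [])) , compile-computes solutionHeadᴱ (X ⊕ Ŷ)
            , Backward.recurs X colour<colours Ŷ sol
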